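{- Let $n\ge1$, $S=\{s_1<\cdots<s_k\}\subseteq[n-1]$, $s_0=0$, $s_{k+1}=n$ (so $s_1=n$ when $S=\emptyset$). Then the number $\alpha^+_n(S)$ of $\sigma\in\mathcal{B}^+_n$ whose descent set is contained in $S$ equals $$\alpha^+_n(S)=\frac{n!}{\prod_{i=0}^{k}(s_{i+1}-s_i)!}\,2^{\,n-s_1}.$$
   Context: $\mathcal{B}_n$ is the set of signed permutations of $\{\pm1,\dots,\pm n\}$ ($\sigma(-i)=-\sigma(i)$), each identified with the word $\sigma(0)\sigma(1)\cdots\sigma(n)$ with $\sigma(0)=0$; $\mathcal{B}^+_n$ is the subset with $\sigma(1)>0$. The descent set of $\sigma$ is the set of positions $i\in\{0,\dots,n-1\}$ with $\sigma(i)>\sigma(i+1)$. -}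

module Defs where

open import Data.Nat as ℕ using (ℕ; zero; suc; _∸_; _^_; _!)
open import Data.Integer as ℤ using (ℤ; ∣_∣; _<_; _<?_; +_)
open import Data.Fin using (Fin; toℕ; inject₁)
open import Data.Fin.Properties using (all?)
open import Data.Vec using (Vec; lookup)
open import Data.List using (List; []; _∷_; _++_; [_]; map)
open import Data.Nat.ListAction using (product)
open import Data.List.Membership.Propositional using (_∈_)
open import Data.List.Membership.DecPropositional ℕ._≟_ using (_∈?_)
open import Data.Product using (_×_; Σ)
open import Relation.Binary.PropositionalEquality using (_≡_)
open import Relation.Nullary using (Dec; ¬_)
open import Relation.Nullary.Decidable using (True; _×-dec_; _→-dec_)
import Data.Fin as F

-- A signed permutation σ ∈ 𝓑ₙ is identified with its word σ(1)⋯σ(n),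
-- stored as a vector w of integers (w[i] = σ(i+1)).
IsSignedPerm : (n : ℕ) → Vec ℤ n → Set
IsSignedPerm n w =
  ((i : Fin n) → (1 ℕ.≤ ∣ lookup w i ∣) × (∣ lookup w i ∣ ℕ.≤ n)) ×
  ((i j : Fin n) → ∣ lookup w i ∣ ≡ ∣ lookup w j ∣ → i ≡ j)

isSignedPerm? : (n : ℕ) → (w : Vec ℤ n) → Dec (IsSignedPerm n w)
isSignedPerm? n w =
  all? (λ i → (1 ℕ.≤? ∣ lookup w i ∣) ×-dec (∣ lookup w i ∣ ℕ.≤? n))
  ×-dec all? (λ i → all? (λ j → (∣ lookup w i ∣ ℕ.≟ ∣ lookup w j ∣) →-dec (i F.≟ j)))

σat : {n : ℕ} → Vec ℤ n → Fin (suc n) → ℤ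
σat w F.zero    = + 0
σat w (F.suc i) = lookup w i

-- σ ∈ 𝓑⁺ₙ : σ(1) > 0 (i.e. the entry at position 1, index 0 of the vector).
IsPositiveFirst : (n : ℕ) → Vec ℤ n → Set
IsPositiveFirst n w = (i : Fin n) → toℕ i ≡ 0 → + 0 < lookup w i

isPositiveFirst? : (n : ℕ) → (w : Vec ℤ n) → Dec (IsPositiveFirst n w)
isPositiveFirst? n w = all? (λ i → (toℕ i ℕ.≟ 0) →-dec (+ 0 <? lookup w i))

DesSubset : (n : ℕ) → Vec ℤ n → List ℕ → Set
DesSubset n w S = (i : Fin n) → σat w (F.suc i) < σat w (inject₁ i) → toℕ i ∈ S

desSubset? : (n : ℕ) → (w : Vec ℤ n) → (S : List ℕ) → Dec (DesSubset n w S)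
desSubset? n w S = all? (λ i → (σat w (F.suc i) <? σat w (inject₁ i)) →-dec (toℕ i ∈? S))

-- The set counted by α⁺ₙ(S): signed permutations in 𝓑⁺ₙ with Des(σ) ⊆ S.
-- The (decidable) membership proof is wrapped in `True`, so it is proof-irrelevant.
Counted : (n : ℕ) → List ℕ → Set
Counted n S = Σ (Vec ℤ n) λ w →
  True (isSignedPerm? n w ×-dec isPositiveFirst? n w ×-dec desSubset? n w S)

diffs : List ℕ → List ℕ
diffs []            = []
diffs (a ∷ [])      = []
diffs (a ∷ b ∷ xs)  = (b ∸ a) ∷ diffs (b ∷ xs)

firstOr : ℕ → List ℕ → ℕ
firstOr n []      = n
firstOr n (s ∷ _) = s

prodFactGaps : ℕ → List ℕ → ℕ
prodFactGaps n S = product (map _! (diffs (0 ∷ S ++ [ n ])))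

module Submission where

-- Write σ ∈ 𝓑ₙ as the word 0 σ(1) ⋯ σ(n) and encode S by the Boolean pattern E on the gaps
-- 0, …, n − 1 of the word (E[i] = i ∈ S). As 0 ∉ S, the σ ∈ 𝓑⁺ₙ with Des(σ) ⊆ S are exactly the
-- signed permutations whose descents all lie in permitted gaps.
--
-- Deleting the letter ±m of largest absolute value from such a word of length m leaves a word of
-- length m − 1 that respects E with the two gaps around the deleted letter fused. Conversely, ±m
-- can be inserted at a position of the shorter word as +m if the gap after it is permitted (or it
-- ends the word) and as −m if the gap before it is. This gives a recurrence for the number of such
-- words.
--
-- The permitted gaps cut 1, …, m into blocks of sizes c₀, c₁, …, cₖ, the first one following
-- σ(0) = 0, and the claimed number is m! 2ᵐ / (c₀! 2^c₀ c₁! ⋯ cₖ!). It satisfies the same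
-- recurrence: deleting the largest letter of block j divides that denominator by cⱼ (by 2c₀ if
-- j = 0), and as the largest letter of block j > 0 can be first (negative) or last (positive),
-- while that of block 0 can only be last, these quotients sum to 2(c₀ + ⋯ + cₖ) = 2m. Everything
-- is kept in ℕ by proving count · denominator = m! 2ᵐ.

open import Defs
open import Data.Nat as ℕ using (ℕ; zero; suc; _+_; _*_; _∸_; _^_; _!; _≤_; _<_; z≤n; s≤s)
open import Data.Nat.Properties
  using ( +-comm; +-suc; +-identityʳ; *-identityˡ; *-identityʳ; *-assoc; *-comm
        ; +-cancelʳ-≡; *-cancelʳ-≡; m+n∸m≡n; m∸n+n≡m; ^-distribˡ-+-*; m^n≢0; ∸-monoʳ-<; ∸-cancelʳ-≡
        ; ≤-refl; ≤-pred; <⇒≤; <-irrefl; <-trans; ≤-<-trans; <-≤-trans; ≤∧≢⇒<; ≤⇒≯; 1+n≰n; n<1+n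
        ; m≤n⇒m≤1+n; m<n⇒m<1+n; +-*-semiring; *-commutativeSemigroup)
open import Data.Nat.Tactic.RingSolver using (solve-∀)
open import Data.Nat.ListAction using (product)
open import Data.Integer as ℤ using (ℤ; ∣_∣; +_; -[1+_]; _◃_; sign; +<+; -<+; -<-)
open import Data.Integer.Properties using (<-asym; abs-◃; sign-◃; ◃-inverse)
open import Data.Sign using (Sign)
open import Data.Bool using (Bool; true; false; _∨_; _∧_; not; T; if_then_else_)
open import Data.Bool.Properties using (∨-zeroʳ; ∨-identityʳ; ∧-commutativeMonoid; T-irrelevant; T-∧)
open import Data.Unit using (tt)
open import Data.Empty using (⊥-elim)
open import Data.Fin as Fin using (Fin; zero; suc; toℕ; inject₁; fromℕ<; punchIn)
open import Data.Fin.Properties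
  using (punchIn-punchOut; punchIn-injective; punchInᵢ≢i; any?; injective⇒≤; fromℕ<-injective; +↔⊎; *↔×)
open import Data.Fin.Permutation using (↔⇒≡)
open import Data.Vec using (Vec; []; _∷_; lookup; head; insertAt; removeAt)
open import Data.Vec.Properties using (insertAt-lookup; insertAt-punchIn; insertAt-removeAt; removeAt-insertAt)
open import Data.List using (List; []; _∷_; _++_; [_]; map)
open import Data.List.Relation.Unary.All as All using (All; []; _∷_)
open import Data.List.Relation.Unary.Any using (here; there)
open import Data.List.Relation.Unary.AllPairs using (_∷_)
open import Data.List.Relation.Unary.Linked as Linked using (Linked)
open import Data.List.Relation.Unary.Linked.Properties using (Linked⇒AllPairs)
open import Data.List.Membership.Propositional using (_∈_)
open import Data.List.Membership.DecPropositional ℕ._≟_ using (_∈?_)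
open import Data.Product using (Σ; _×_; _,_; proj₁; proj₂)
open import Data.Product.Function.NonDependent.Propositional using (_×-↔_)
open import Data.Sum using (_⊎_; inj₁; inj₂)
open import Data.Sum.Function.Propositional using (_⊎-↔_)
open import Function using (_∘_)
open import Function.Bundles using (_↔_; _⇔_; mk↔ₛ′; mk⇔; Equivalence)
open import Function.Properties.Inverse using (↔-trans; ↔-sym)
open import Relation.Nullary using (Dec; yes; no; ¬_)
open import Relation.Nullary.Decidable using (does; dec-true; dec-false; True; toWitness; fromWitness)
open import Relation.Binary.PropositionalEquality hiding ([_])
open import Algebra.Bundles using (CommutativeMonoid)
open import Algebra.Properties.Semiring.Sum +-*-semiring using (sum; sum-cong-≗; *-distribʳ-sum)
import Algebra.Properties.CommutativeSemigroup as CommutativeSemigroupProperties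

open ≡-Reasoning
open Equivalence using (to; from)
open CommutativeSemigroupProperties *-commutativeSemigroup using (x∙yz≈y∙xz)
module ∧ = CommutativeSemigroupProperties (CommutativeMonoid.commutativeSemigroup ∧-commutativeMonoid)

χ : Bool → ℕ
χ true  = 1
χ false = 0

T↔Fin-χ : ∀ b → T b ↔ Fin (χ b)
T↔Fin-χ true  = mk↔ₛ′ (λ _ → zero) (λ _ → tt) (λ { zero → refl }) (λ _ → refl)
T↔Fin-χ false = mk↔ₛ′ (λ ()) (λ ()) (λ ()) (λ ())

Σ-Sign↔Fin : (P : Sign → Bool) → Σ Sign (T ∘ P) ↔ Fin (χ (P Sign.+) + χ (P Sign.-))
Σ-Sign↔Fin P = ↔-trans split (↔-trans (T↔Fin-χ (P Sign.+) ⊎-↔ T↔Fin-χ (P Sign.-)) (↔-sym +↔⊎))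
  where
  split : Σ Sign (T ∘ P) ↔ (T (P Sign.+) ⊎ T (P Sign.-))
  split = mk↔ₛ′ (λ { (Sign.+ , t) → inj₁ t ; (Sign.- , t) → inj₂ t })
                (λ { (inj₁ t) → Sign.+ , t ; (inj₂ t) → Sign.- , t })
                (λ { (inj₁ _) → refl ; (inj₂ _) → refl })
                (λ { (Sign.+ , _) → refl ; (Sign.- , _) → refl })

Σ-Fin↔Fin-sum : ∀ {k} {B : Fin k → Set} (g : Fin k → ℕ) →
                (∀ q → B q ↔ Fin (g q)) → Σ (Fin k) B ↔ Fin (sum g)
Σ-Fin↔Fin-sum {zero}      g B↔ = mk↔ₛ′ (λ ()) (λ ()) (λ ()) (λ ())
Σ-Fin↔Fin-sum {suc k} {B} g B↔ =
  ↔-trans split (↔-trans (B↔ zero ⊎-↔ Σ-Fin↔Fin-sum (g ∘ suc) (B↔ ∘ suc)) (↔-sym +↔⊎))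
  where
  split : Σ (Fin (suc k)) B ↔ (B zero ⊎ Σ (Fin k) (B ∘ suc))
  split = mk↔ₛ′ (λ { (zero , b) → inj₁ b ; (suc q , b) → inj₂ (q , b) })
                (λ { (inj₁ b) → zero , b ; (inj₂ (q , b)) → suc q , b })
                (λ { (inj₁ _) → refl ; (inj₂ _) → refl })
                (λ { (zero , _) → refl ; (suc _ , _) → refl })

T-does⇔ : ∀ {P : Set} (d : Dec P) → T (does d) ⇔ P
T-does⇔ (yes p) = mk⇔ (λ _ → p) (λ _ → tt)
T-does⇔ (no ¬p) = mk⇔ (λ ()) ¬p

T-∨-not-does⇔ : ∀ {P : Set} b (d : Dec P) → T (b ∨ not (does d)) ⇔ (P → T b)
T-∨-not-does⇔ true  d       = mk⇔ (λ _ _ → tt) (λ _ → tt)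
T-∨-not-does⇔ false (yes p) = mk⇔ (λ ()) (λ p⇒⊥ → p⇒⊥ p)
T-∨-not-does⇔ false (no ¬p) = mk⇔ (λ _ p → ⊥-elim (¬p p)) (λ _ → tt)

-- Descent patterns

descentsWithin : ∀ {k} → Vec Bool k → Vec ℤ (suc k) → Bool
descentsWithin []      (_ ∷ [])    = true
descentsWithin (b ∷ E) (x ∷ y ∷ w) = (b ∨ not (does (y ℤ.<? x))) ∧ descentsWithin E (y ∷ w)

T-descentsWithin⇔ : ∀ {k} (E : Vec Bool k) (u : Vec ℤ (suc k)) →
  T (descentsWithin E u) ⇔ (∀ i → lookup u (suc i) ℤ.< lookup u (inject₁ i) → T (lookup E i))
T-descentsWithin⇔ []      (_ ∷ [])    = mk⇔ (λ _ ()) (λ _ → tt)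
T-descentsWithin⇔ (b ∷ E) (x ∷ y ∷ w) = mk⇔ to′ from′
  where
  u = x ∷ y ∷ w
  Descents⊆ = ∀ i → lookup u (suc i) ℤ.< lookup u (inject₁ i) → T (lookup (b ∷ E) i)
  head⇔ = T-∨-not-does⇔ b (y ℤ.<? x)
  tail⇔ = T-descentsWithin⇔ E (y ∷ w)
  to′ : T (descentsWithin (b ∷ E) u) → Descents⊆
  to′ t zero    = to head⇔ (proj₁ (to T-∧ t))
  to′ t (suc i) = to tail⇔ (proj₂ (to T-∧ t)) i
  from′ : Descents⊆ → T (descentsWithin (b ∷ E) u)
  from′ h = from T-∧ (from head⇔ (h zero) , from tail⇔ (h ∘ suc))

-- Deleting the letter x_{q+1} of a word merges its gaps q and q + 1 (the last gap just disappears).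
fuse : ∀ {m} → Vec Bool (suc m) → Fin (suc m) → Vec Bool m
fuse (b ∷ b′ ∷ E) (suc q) = b ∷ fuse (b′ ∷ E) q
fuse (_ ∷ [])     zero    = []
fuse (b ∷ b′ ∷ E) zero    = (b ∨ b′) ∷ E

permitsAfter : ∀ {m} → Vec Bool (suc m) → Fin (suc m) → Bool
permitsAfter (_ ∷ b′ ∷ E) (suc q) = permitsAfter (b′ ∷ E) q
permitsAfter (_ ∷ [])     zero    = true
permitsAfter (_ ∷ b′ ∷ _) zero    = b′

permitsInsertion : ∀ {m} → Vec Bool (suc m) → Fin (suc m) → Sign → Bool
permitsInsertion E q Sign.+ = permitsAfter E q
permitsInsertion E q Sign.- = lookup E q

∣i∣≤n⇒i<+[1+n] : ∀ {i n} → ∣ i ∣ ≤ n → i ℤ.< + suc n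
∣i∣≤n⇒i<+[1+n] {+ _}       ∣i∣≤n = +<+ (s≤s ∣i∣≤n)
∣i∣≤n⇒i<+[1+n] { -[1+ _ ]} _     = -<+

∣i∣≤n⇒-[1+n]<i : ∀ {i n} → ∣ i ∣ ≤ n → -[1+ n ] ℤ.< i
∣i∣≤n⇒-[1+n]<i {+ _}       _     = -<+
∣i∣≤n⇒-[1+n]<i { -[1+ _ ]} ∣i∣≤n = -<- ∣i∣≤n

-- The inserted letter ±(k+1) exceeds every ∣uⱼ∣, so it creates exactly one descent, right after it
-- if positive and right before it if negative; the fused gap b ∨ b′ is then permitted, so the pair
-- of letters it separates is unconstrained on both sides.
descentsWithin-insertAt : ∀ {m} k (E : Vec Bool (suc m)) (u : Vec ℤ (suc m)) q s →
  (∀ j → ∣ lookup u j ∣ ≤ k) →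
  descentsWithin E (insertAt u (suc q) (s ◃ suc k)) ≡ permitsInsertion E q s ∧ descentsWithin (fuse E q) u
descentsWithin-insertAt {suc m} k (b ∷ b′ ∷ E) (x ∷ y ∷ u) (suc q) Sign.+ bound =
  trans (cong (xy ∧_) (descentsWithin-insertAt {m} k (b′ ∷ E) (y ∷ u) q Sign.+ (bound ∘ suc)))
        (∧.x∙yz≈y∙xz xy (permitsAfter (b′ ∷ E) q) _)
  where xy = b ∨ not (does (y ℤ.<? x))
descentsWithin-insertAt {suc m} k (b ∷ b′ ∷ E) (x ∷ y ∷ u) (suc q) Sign.- bound =
  trans (cong (xy ∧_) (descentsWithin-insertAt {m} k (b′ ∷ E) (y ∷ u) q Sign.- (bound ∘ suc)))
        (∧.x∙yz≈y∙xz xy (lookup (b′ ∷ E) q) _)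
  where xy = b ∨ not (does (y ℤ.<? x))
descentsWithin-insertAt k (b ∷ []) (x ∷ []) zero Sign.+ bound
  rewrite dec-false (+ suc k ℤ.<? x) (<-asym (∣i∣≤n⇒i<+[1+n] (bound zero))) = cong (_∧ true) (∨-zeroʳ b)
descentsWithin-insertAt k (b ∷ []) (x ∷ []) zero Sign.- bound
  rewrite dec-true (-[1+ k ] ℤ.<? x) (∣i∣≤n⇒-[1+n]<i (bound zero)) = cong (_∧ true) (∨-identityʳ b)
descentsWithin-insertAt k (b ∷ b′ ∷ E) (x ∷ y ∷ u) zero Sign.+ bound
  rewrite dec-false (+ suc k ℤ.<? x) (<-asym (∣i∣≤n⇒i<+[1+n] (bound zero)))
        | dec-true (y ℤ.<? + suc k) (∣i∣≤n⇒i<+[1+n] (bound (suc zero))) = absorb b b′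
  where
  absorb : ∀ b b′ {t D} → (b ∨ true) ∧ ((b′ ∨ false) ∧ D) ≡ b′ ∧ (((b ∨ b′) ∨ t) ∧ D)
  absorb false false = refl
  absorb false true  = refl
  absorb true  false = refl
  absorb true  true  = refl
descentsWithin-insertAt k (b ∷ b′ ∷ E) (x ∷ y ∷ u) zero Sign.- bound
  rewrite dec-true (-[1+ k ] ℤ.<? x) (∣i∣≤n⇒-[1+n]<i (bound zero))
        | dec-false (y ℤ.<? -[1+ k ]) (<-asym (∣i∣≤n⇒-[1+n]<i (bound (suc zero)))) = absorb b b′
  where
  absorb : ∀ b b′ {t D} → (b ∨ false) ∧ ((b′ ∨ true) ∧ D) ≡ b ∧ (((b ∨ b′) ∨ t) ∧ D)
  absorb false false = refl
  absorb false true  = refl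
  absorb true  false = refl
  absorb true  true  = refl

-- Inserting and removing the letter of largest absolute value

data PunchView {m} (p : Fin (suc m)) : Fin (suc m) → Set where
  at      : PunchView p p
  punched : ∀ j → PunchView p (punchIn p j)

punchView : ∀ {m} (p i : Fin (suc m)) → PunchView p i
punchView p i with i Fin.≟ p
... | yes refl = at
... | no  i≢p  = subst (PunchView p) (punchIn-punchOut (i≢p ∘ sym)) (punched _)

module _ {m} (τ : Vec ℤ m) (p : Fin (suc m)) (s : Sign) where

  private
    w = insertAt τ p (s ◃ suc m)

    ∣w[p]∣ : ∣ lookup w p ∣ ≡ suc m
    ∣w[p]∣ = trans (cong ∣_∣ (insertAt-lookup τ p (s ◃ suc m))) (abs-◃ s (suc m))

    ∣w[p↑j]∣ : ∀ j → ∣ lookup w (punchIn p j) ∣ ≡ ∣ lookup τ j ∣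
    ∣w[p↑j]∣ j = cong ∣_∣ (insertAt-punchIn τ p (s ◃ suc m) j)

  insertAt-IsSignedPerm : IsSignedPerm m τ → IsSignedPerm (suc m) w
  insertAt-IsSignedPerm (bounds , inj) = bounds′ , inj′
    where
    bounds′ : ∀ i → 1 ≤ ∣ lookup w i ∣ × ∣ lookup w i ∣ ≤ suc m
    bounds′ i with punchView p i
    ... | at        rewrite ∣w[p]∣     = s≤s z≤n , ≤-refl
    ... | punched j rewrite ∣w[p↑j]∣ j = proj₁ (bounds j) , m≤n⇒m≤1+n (proj₂ (bounds j))
    not-max : ∀ j → ∣ lookup τ j ∣ ≢ suc m
    not-max j eq = 1+n≰n (subst (_≤ m) eq (proj₂ (bounds j)))
    inj′ : ∀ i i′ → ∣ lookup w i ∣ ≡ ∣ lookup w i′ ∣ → i ≡ i′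
    inj′ i i′ eq with punchView p i | punchView p i′
    ... | at        | at         = refl
    ... | at        | punched j′ = ⊥-elim (not-max j′ (trans (sym (∣w[p↑j]∣ j′)) (trans (sym eq) ∣w[p]∣)))
    ... | punched j | at         = ⊥-elim (not-max j (trans (sym (∣w[p↑j]∣ j)) (trans eq ∣w[p]∣)))
    ... | punched j | punched j′ =
      cong (punchIn p) (inj j j′ (trans (sym (∣w[p↑j]∣ j)) (trans eq (∣w[p↑j]∣ j′))))

  insertAt-IsSignedPerm⁻ : IsSignedPerm (suc m) w → IsSignedPerm m τ
  insertAt-IsSignedPerm⁻ (bounds , inj) = bounds′ , inj′
    where
    ∣τ[j]∣≢1+m : ∀ j → ∣ lookup τ j ∣ ≢ suc m
    ∣τ[j]∣≢1+m j eq = punchInᵢ≢i p j (inj _ _ (trans (∣w[p↑j]∣ j) (trans eq (sym ∣w[p]∣))))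
    bounds′ : ∀ j → 1 ≤ ∣ lookup τ j ∣ × ∣ lookup τ j ∣ ≤ m
    bounds′ j = subst (1 ≤_) (∣w[p↑j]∣ j) (proj₁ (bounds (punchIn p j))) ,
                ≤-pred (≤∧≢⇒< (subst (_≤ suc m) (∣w[p↑j]∣ j) (proj₂ (bounds (punchIn p j)))) (∣τ[j]∣≢1+m j))
    inj′ : ∀ j j′ → ∣ lookup τ j ∣ ≡ ∣ lookup τ j′ ∣ → j ≡ j′
    inj′ j j′ eq = punchIn-injective p j j′ (inj _ _ (trans (∣w[p↑j]∣ j) (trans eq (sym (∣w[p↑j]∣ j′)))))

positionOfMax : ∀ {m} (w : Vec ℤ (suc m)) → IsSignedPerm (suc m) w →
                Σ (Fin (suc m)) λ p → ∣ lookup w p ∣ ≡ suc m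
positionOfMax {m} w (bounds , inj) with any? (λ i → ∣ lookup w i ∣ ℕ.≟ suc m)
... | yes found = found
... | no  none  = ⊥-elim (1+n≰n (injective⇒≤ index-injective))
  where
  ∣w[i]∣∸1<m : ∀ i → ∣ lookup w i ∣ ∸ 1 < m
  ∣w[i]∣∸1<m i = <-≤-trans (∸-monoʳ-< (s≤s z≤n) (proj₁ (bounds i)))
                           (≤-pred (≤∧≢⇒< (proj₂ (bounds i)) (λ eq → none (i , eq))))
  index : Fin (suc m) → Fin m
  index i = fromℕ< (∣w[i]∣∸1<m i)
  index-injective : ∀ {i j} → index i ≡ index j → i ≡ j
  index-injective {i} {j} eq = inj i j (∸-cancelʳ-≡ (proj₁ (bounds i)) (proj₁ (bounds j))
                                                    (fromℕ<-injective _ _ (∣w[i]∣∸1<m i) (∣w[i]∣∸1<m j) eq))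

IsSignedPerm⇒bounded : ∀ {m} (τ : Vec ℤ m) → IsSignedPerm m τ → ∀ j → ∣ lookup (+ 0 ∷ τ) j ∣ ≤ m
IsSignedPerm⇒bounded τ _            zero    = z≤n
IsSignedPerm⇒bounded τ (bounds , _) (suc j) = proj₂ (bounds j)

insertAt-removeAt-max : ∀ {m} (w : Vec ℤ (suc m)) p → ∣ lookup w p ∣ ≡ suc m →
  insertAt (removeAt w p) p (sign (lookup w p) ◃ suc m) ≡ w
insertAt-removeAt-max {m} w p ∣w[p]∣≡1+m = begin
  insertAt τ p (sign x ◃ suc m)  ≡⟨ cong (insertAt τ p ∘ (sign x ◃_)) ∣w[p]∣≡1+m ⟨
  insertAt τ p (sign x ◃ ∣ x ∣)  ≡⟨ cong (insertAt τ p) (◃-inverse x) ⟩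
  insertAt τ p x                 ≡⟨ insertAt-removeAt w p ⟩
  w                              ∎
  where
  x = lookup w p
  τ = removeAt w p

-- The recurrence

DesWithin : (m : ℕ) → Vec Bool m → Set
DesWithin m E = Σ (Vec ℤ m) λ w → True (isSignedPerm? m w) × T (descentsWithin E (+ 0 ∷ w))

DesWithin-≡ : ∀ {m E} {x y : DesWithin m E} → proj₁ x ≡ proj₁ y → x ≡ y
DesWithin-≡ {x = w , sp , d} {.w , sp′ , d′} refl =
  cong₂ (λ sp d → w , sp , d) (T-irrelevant sp sp′) (T-irrelevant d d′)

Insertion : (m : ℕ) → Vec Bool (suc m) → Set
Insertion m E = Σ (Fin (suc m)) λ q → Σ Sign (T ∘ permitsInsertion E q) × DesWithin m (fuse E q)

Insertion-≡ : ∀ {m E} {x y : Insertion m E} → proj₁ x ≡ proj₁ y →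
  (let (_ , (s , _) , (τ , _)) = x ; (_ , (s′ , _) , (τ′ , _)) = y in s ≡ s′ × τ ≡ τ′) → x ≡ y
Insertion-≡ {E = E} {x = q , (s , c) , τ} {.q , (.s , c′) , τ′} refl (refl , τ≡τ′) =
  cong₂ (λ c τ → q , (s , c) , τ) (T-irrelevant c c′) (DesWithin-≡ {E = fuse E q} τ≡τ′)

module _ {m} (E : Vec Bool (suc m)) where

  insertMax : Insertion m E → DesWithin (suc m) E
  insertMax (q , (s , c) , (τ , sp , d)) =
    insertAt τ q (s ◃ suc m) ,
    fromWitness (insertAt-IsSignedPerm τ q s (toWitness sp)) ,
    subst T (sym (descentsWithin-insertAt m E (+ 0 ∷ τ) q s (IsSignedPerm⇒bounded τ (toWitness sp))))
          (from T-∧ (c , d))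

  removeMax : DesWithin (suc m) E → Insertion m E
  removeMax (w , sp , d) = p , (s , proj₁ parts) , (τ , fromWitness spτ , proj₂ parts)
    where
    p = proj₁ (positionOfMax w (toWitness sp))
    s = sign (lookup w p)
    τ = removeAt w p
    w≡ : insertAt τ p (s ◃ suc m) ≡ w
    w≡ = insertAt-removeAt-max w p (proj₂ (positionOfMax w (toWitness sp)))
    spτ : IsSignedPerm m τ
    spτ = insertAt-IsSignedPerm⁻ τ p s (subst (IsSignedPerm (suc m)) (sym w≡) (toWitness sp))
    parts : T (permitsInsertion E p s) × T (descentsWithin (fuse E p) (+ 0 ∷ τ))
    parts = to T-∧ (subst T (descentsWithin-insertAt m E (+ 0 ∷ τ) p s (IsSignedPerm⇒bounded τ spτ))
                              (subst (λ w → T (descentsWithin E (+ 0 ∷ w))) (sym w≡) d))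

  removeMax-insertMax : ∀ x → removeMax (insertMax x) ≡ x
  removeMax-insertMax x@(q , (s , _) , (τ , _)) = Insertion-≡ {E = E} p≡q (s′≡s , τ′≡τ)
    where
    v = s ◃ suc m
    w = insertAt τ q v
    sp = toWitness (proj₁ (proj₂ (insertMax x)))
    p = proj₁ (positionOfMax w sp)
    ∣w[q]∣ : ∣ lookup w q ∣ ≡ suc m
    ∣w[q]∣ = trans (cong ∣_∣ (insertAt-lookup τ q v)) (abs-◃ s (suc m))
    p≡q : p ≡ q
    p≡q = proj₂ sp p q (trans (proj₂ (positionOfMax w sp)) (sym ∣w[q]∣))
    s′≡s : sign (lookup w p) ≡ s
    s′≡s = trans (cong (sign ∘ lookup w) p≡q) (trans (cong sign (insertAt-lookup τ q v)) (sign-◃ s (suc m)))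
    τ′≡τ : removeAt w p ≡ τ
    τ′≡τ = trans (cong (removeAt w) p≡q) (removeAt-insertAt τ q v)

  insertMax-removeMax : ∀ x → insertMax (removeMax x) ≡ x
  insertMax-removeMax (w , sp , _) =
    DesWithin-≡ {E = E} (insertAt-removeAt-max w _ (proj₂ (positionOfMax w (toWitness sp))))

  DesWithin↔Insertion : DesWithin (suc m) E ↔ Insertion m E
  DesWithin↔Insertion = mk↔ₛ′ removeMax insertMax removeMax-insertMax insertMax-removeMax

signChoices : ∀ {m} → Vec Bool (suc m) → Fin (suc m) → ℕ
signChoices E q = χ (permitsInsertion E q Sign.+) + χ (permitsInsertion E q Sign.-)

count : (m : ℕ) → Vec Bool m → ℕ
count zero    [] = 1
count (suc m) E  = sum λ q → signChoices E q * count m (fuse E q)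

DesWithin↔Fin-count : ∀ m (E : Vec Bool m) → DesWithin m E ↔ Fin (count m E)
DesWithin↔Fin-count zero    [] =
  mk↔ₛ′ (λ _ → zero) (λ _ → empty) (λ { zero → refl }) (λ { ([] , _) → DesWithin-≡ {E = []} refl })
  where
  empty : DesWithin 0 []
  empty = [] , fromWitness {a? = isSignedPerm? 0 []} ((λ ()) , (λ ())) , tt
DesWithin↔Fin-count (suc m) E  =
  ↔-trans (DesWithin↔Insertion E)
          (Σ-Fin↔Fin-sum _ λ q → ↔-trans (Σ-Sign↔Fin (permitsInsertion E q) ×-↔ DesWithin↔Fin-count m (fuse E q))
                                         (↔-sym *↔×))

-- The closed form satisfies the recurrence

leadingFalses : ∀ {k} → Vec Bool k → ℕ
leadingFalses []          = 0
leadingFalses (false ∷ E) = suc (leadingFalses E)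
leadingFalses (true ∷ _)  = 0

-- The true entries of E cut the positions into blocks. The first block, which already has c
-- elements before E starts, is weighted by w of its size, every later block by the factorial of its size.
weightedBlocks : ∀ {k} → (ℕ → ℕ) → ℕ → Vec Bool k → ℕ
weightedBlocks w c []          = w c
weightedBlocks w c (false ∷ E) = weightedBlocks w (suc c) E
weightedBlocks w c (true ∷ E)  = w c * weightedBlocks _! 1 E

-- weightedBlocks w c E / weightedBlocks w c (fuse E q) for a weight with w (suc c) = a * suc c * w c,
-- i.e. a times the size of the first block or the size of a later block; the value 0 for a
-- position q where no insertion is permitted is junk.
blockRatio : ∀ {m} → ℕ → ℕ → Vec Bool (suc m) → Fin (suc m) → ℕ
blockRatio a c (false ∷ b′ ∷ E) (suc q)  = blockRatio a (suc c) (b′ ∷ E) q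
blockRatio a c (true ∷ b′ ∷ E)  (suc q)  = blockRatio 1 1 (b′ ∷ E) q
blockRatio a c (b ∷ [])            zero  = if b then 1 else a * suc c
blockRatio a c (false ∷ false ∷ E) zero  = 0
blockRatio a c (false ∷ true ∷ E)  zero  = a * suc c
blockRatio a c (true ∷ true ∷ E)   zero  = 1
blockRatio a c (true ∷ false ∷ E)  zero  = 2 + leadingFalses E

signedPerms : ℕ → ℕ
signedPerms c = c ! * 2 ^ c

factorial-suc : ∀ c → suc c ! ≡ 1 * suc c * c !
factorial-suc c = cong (_* c !) (sym (*-identityˡ (suc c)))

signedPerms-suc : ∀ c → signedPerms (suc c) ≡ 2 * suc c * signedPerms c
signedPerms-suc c = lemma c (c !) (2 ^ c)
  where
  lemma : ∀ c f p → suc c * f * (2 * p) ≡ 2 * suc c * (f * p)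
  lemma = solve-∀

weightedBlocks-!-suc : ∀ {k} c (E : Vec Bool k) →
  weightedBlocks _! (suc c) E ≡ (suc c + leadingFalses E) * weightedBlocks _! c E
weightedBlocks-!-suc c []          = cong (_* c !) (sym (+-identityʳ (suc c)))
weightedBlocks-!-suc c (false ∷ E) = begin
  weightedBlocks _! (2 + c) E                                ≡⟨ weightedBlocks-!-suc (suc c) E ⟩
  (2 + c + leadingFalses E) * W                             ≡⟨ cong (_* W) (+-suc (suc c) (leadingFalses E)) ⟨
  (suc c + suc (leadingFalses E)) * W                       ∎
  where W = weightedBlocks _! (suc c) E
weightedBlocks-!-suc c (true ∷ E)  = begin
  suc c * c ! * weightedBlocks _! 1 E          ≡⟨ *-assoc (suc c) (c !) _ ⟩
  suc c * (c ! * weightedBlocks _! 1 E)        ≡⟨ cong (_* (c ! * weightedBlocks _! 1 E)) (+-identityʳ (suc c)) ⟨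
  (suc c + 0) * (c ! * weightedBlocks _! 1 E)  ∎

weightedBlocks-fuse : ∀ {m} (w : ℕ → ℕ) a → (∀ c → w (suc c) ≡ a * suc c * w c) →
  ∀ c (E : Vec Bool (suc m)) q → 0 < signChoices E q →
  weightedBlocks w c E ≡ blockRatio a c E q * weightedBlocks w c (fuse E q)
weightedBlocks-fuse w a w-suc c (false ∷ [])        zero _ = w-suc c
weightedBlocks-fuse w a w-suc c (true ∷ [])         zero _ = trans (*-identityʳ (w c)) (sym (*-identityˡ (w c)))
weightedBlocks-fuse w a w-suc c (false ∷ false ∷ E) zero ()
weightedBlocks-fuse w a w-suc c (false ∷ true ∷ E)  zero _ = begin
  w (suc c) * weightedBlocks _! 1 E          ≡⟨ cong (_* _) (w-suc c) ⟩
  a * suc c * w c * weightedBlocks _! 1 E    ≡⟨ *-assoc (a * suc c) (w c) _ ⟩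
  a * suc c * (w c * weightedBlocks _! 1 E)  ∎
weightedBlocks-fuse w a w-suc c (true ∷ true ∷ E)   zero _ =
  trans (cong (w c *_) (*-identityˡ _)) (sym (*-identityˡ _))
weightedBlocks-fuse w a w-suc c (true ∷ false ∷ E)  zero _ = begin
  w c * weightedBlocks _! 2 E                            ≡⟨ cong (w c *_) (weightedBlocks-!-suc 1 E) ⟩
  w c * ((2 + leadingFalses E) * weightedBlocks _! 1 E)  ≡⟨ x∙yz≈y∙xz (w c) (2 + leadingFalses E) _ ⟩
  (2 + leadingFalses E) * (w c * weightedBlocks _! 1 E)  ∎
weightedBlocks-fuse {suc m} w a w-suc c (false ∷ b′ ∷ E) (suc q) h =
  weightedBlocks-fuse {m} w a w-suc (suc c) (b′ ∷ E) q h
weightedBlocks-fuse {suc m} w a w-suc c (true ∷ b′ ∷ E)  (suc q) h = begin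
  w c * weightedBlocks _! 1 (b′ ∷ E)
    ≡⟨ cong (w c *_) (weightedBlocks-fuse {m} _! 1 factorial-suc 1 (b′ ∷ E) q h) ⟩
  w c * (r * weightedBlocks _! 1 (fuse (b′ ∷ E) q))
    ≡⟨ x∙yz≈y∙xz (w c) r _ ⟩
  r * (w c * weightedBlocks _! 1 (fuse (b′ ∷ E) q))
    ∎
  where r = blockRatio 1 1 (b′ ∷ E) q

-- Each position outside the first block contributes 2, and the first block, if it meets E at all,
-- contributes a times its size.
∑-blockRatio : ∀ {m} a c (E : Vec Bool (suc m)) →
  sum (λ q → signChoices E q * blockRatio a c E q) + 2 * leadingFalses E
    ≡ 2 * suc m + (if head E then 0 else a * (c + leadingFalses E))
∑-blockRatio a c (false ∷ []) = lemma a c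
  where
  lemma : ∀ a c → 1 * (a * suc c) + 0 + 2 * 1 ≡ 2 * 1 + a * (c + 1)
  lemma = solve-∀
∑-blockRatio a c (true ∷ []) = refl
∑-blockRatio {suc m} a c (false ∷ false ∷ E) = begin
  0 + rest + 2 * suc (suc z)               ≡⟨ lemma₁ rest z ⟩
  rest + 2 * suc z + 2                     ≡⟨ cong (_+ 2) (∑-blockRatio {m} a (suc c) (false ∷ E)) ⟩
  2 * suc m + a * (suc c + suc z) + 2      ≡⟨ lemma₂ m a c z ⟩
  2 * suc (suc m) + a * (c + suc (suc z))  ∎
  where
  z = leadingFalses E
  rest = sum λ q → signChoices (false ∷ E) q * blockRatio a (suc c) (false ∷ E) q
  lemma₁ : ∀ rest z → 0 + rest + 2 * suc (suc z) ≡ rest + 2 * suc z + 2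
  lemma₁ = solve-∀
  lemma₂ : ∀ m a c z → 2 * suc m + a * (suc c + suc z) + 2 ≡ 2 * suc (suc m) + a * (c + suc (suc z))
  lemma₂ = solve-∀
∑-blockRatio {suc m} a c (false ∷ true ∷ E) = begin
  1 * (a * suc c) + rest + 2 * 1           ≡⟨ lemma₁ a c rest ⟩
  rest + 2 * 0 + (a * (c + 1) + 2)         ≡⟨ cong (_+ (a * (c + 1) + 2)) (∑-blockRatio {m} a (suc c) (true ∷ E)) ⟩
  2 * suc m + 0 + (a * (c + 1) + 2)        ≡⟨ lemma₂ m a c ⟩
  2 * suc (suc m) + a * (c + 1)            ∎
  where
  rest = sum λ q → signChoices (true ∷ E) q * blockRatio a (suc c) (true ∷ E) q
  lemma₁ : ∀ a c rest → 1 * (a * suc c) + rest + 2 * 1 ≡ rest + 2 * 0 + (a * (c + 1) + 2)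
  lemma₁ = solve-∀
  lemma₂ : ∀ m a c → 2 * suc m + 0 + (a * (c + 1) + 2) ≡ 2 * suc (suc m) + a * (c + 1)
  lemma₂ = solve-∀
∑-blockRatio {suc m} a c (true ∷ false ∷ E) = +-cancelʳ-≡ (2 * suc z) _ _ (begin
  1 * (2 + z) + rest + 0 + 2 * suc z       ≡⟨ lemma₁ rest z ⟩
  rest + 2 * suc z + (2 + z)               ≡⟨ cong (_+ (2 + z)) (∑-blockRatio {m} 1 1 (false ∷ E)) ⟩
  2 * suc m + 1 * (1 + suc z) + (2 + z)    ≡⟨ lemma₂ m z ⟩
  2 * suc (suc m) + 0 + 2 * suc z          ∎)
  where
  z = leadingFalses E
  rest = sum λ q → signChoices (false ∷ E) q * blockRatio 1 1 (false ∷ E) q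
  lemma₁ : ∀ rest z → 1 * (2 + z) + rest + 0 + 2 * suc z ≡ rest + 2 * suc z + (2 + z)
  lemma₁ = solve-∀
  lemma₂ : ∀ m z → 2 * suc m + 1 * (1 + suc z) + (2 + z) ≡ 2 * suc (suc m) + 0 + 2 * suc z
  lemma₂ = solve-∀
∑-blockRatio {suc m} a c (true ∷ true ∷ E) = begin
  2 * 1 + rest + 0                         ≡⟨ lemma₁ rest ⟩
  rest + 2 * 0 + 2                         ≡⟨ cong (_+ 2) (∑-blockRatio {m} 1 1 (true ∷ E)) ⟩
  2 * suc m + 0 + 2                        ≡⟨ lemma₂ m ⟩
  2 * suc (suc m) + 0                      ∎
  where
  rest = sum λ q → signChoices (true ∷ E) q * blockRatio 1 1 (true ∷ E) q
  lemma₁ : ∀ rest → 2 * 1 + rest + 0 ≡ rest + 2 * 0 + 2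
  lemma₁ = solve-∀
  lemma₂ : ∀ m → 2 * suc m + 0 + 2 ≡ 2 * suc (suc m) + 0
  lemma₂ = solve-∀

∑-blockRatio-2 : ∀ {m} (E : Vec Bool (suc m)) → sum (λ q → signChoices E q * blockRatio 2 0 E q) ≡ 2 * suc m
∑-blockRatio-2 E@(false ∷ _) = +-cancelʳ-≡ (2 * leadingFalses E) _ _ (∑-blockRatio 2 0 E)
∑-blockRatio-2 E@(true ∷ _)  = +-cancelʳ-≡ (2 * leadingFalses E) _ _ (∑-blockRatio 2 0 E)

*-cong-if-nonzero : ∀ k n x r y → (0 < k → x ≡ r * y) → k * n * x ≡ k * r * (n * y)
*-cong-if-nonzero zero    n x r y _    = refl
*-cong-if-nonzero (suc k) n x r y x≡ry = begin
  suc k * n * x        ≡⟨ cong (suc k * n *_) (x≡ry (s≤s z≤n)) ⟩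
  suc k * n * (r * y)  ≡⟨ lemma (suc k) n r y ⟩
  suc k * r * (n * y)  ∎
  where
  lemma : ∀ k n r y → k * n * (r * y) ≡ k * r * (n * y)
  lemma = solve-∀

count*weightedBlocks : ∀ m (E : Vec Bool m) → count m E * weightedBlocks signedPerms 0 E ≡ m ! * 2 ^ m
count*weightedBlocks zero    [] = refl
count*weightedBlocks (suc m) E  = begin
  sum (λ q → k q * count m (fuse E q)) * W E
    ≡⟨ *-distribʳ-sum (W E) (λ q → k q * count m (fuse E q)) ⟩
  sum (λ q → k q * count m (fuse E q) * W E)
    ≡⟨ sum-cong-≗ (λ q → *-cong-if-nonzero (k q) (count m (fuse E q)) (W E) (r q) (W (fuse E q))
                            (weightedBlocks-fuse signedPerms 2 signedPerms-suc 0 E q)) ⟩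
  sum (λ q → k q * r q * (count m (fuse E q) * W (fuse E q)))
    ≡⟨ sum-cong-≗ (λ q → cong (k q * r q *_) (count*weightedBlocks m (fuse E q))) ⟩
  sum (λ q → k q * r q * (m ! * 2 ^ m))
    ≡⟨ *-distribʳ-sum (m ! * 2 ^ m) (λ q → k q * r q) ⟨
  sum (λ q → k q * r q) * (m ! * 2 ^ m)
    ≡⟨ cong (_* (m ! * 2 ^ m)) (∑-blockRatio-2 E) ⟩
  2 * suc m * (m ! * 2 ^ m)
    ≡⟨ signedPerms-suc m ⟨
  suc m ! * 2 ^ suc m
    ∎
  where
  k = signChoices E
  r = blockRatio 2 0 E
  W : ∀ {k} → Vec Bool k → ℕ
  W = weightedBlocks signedPerms 0

-- The pattern of a descent set

indicator : ℕ → (k : ℕ) → List ℕ → Vec Bool k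
indicator o zero    S = []
indicator o (suc k) S = does (o ∈? S) ∷ indicator (suc o) k S

lookup-indicator : ∀ o k S (i : Fin k) → lookup (indicator o k S) i ≡ does ((o + toℕ i) ∈? S)
lookup-indicator o (suc k) S zero    = cong (λ x → does (x ∈? S)) (sym (+-identityʳ o))
lookup-indicator o (suc k) S (suc i) =
  trans (lookup-indicator (suc o) k S i) (cong (λ x → does (x ∈? S)) (sym (+-suc o (toℕ i))))

indicator-∷-< : ∀ {s o} k S → s < o → indicator o k (s ∷ S) ≡ indicator o k S
indicator-∷-< zero    S s<o = refl
indicator-∷-< {s} {o} (suc k) S s<o = cong₂ _∷_ o∈?s∷S (indicator-∷-< k S (m<n⇒m<1+n s<o))
  where
  o∈?s∷S : does (o ∈? (s ∷ S)) ≡ does (o ∈? S)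
  o∈?s∷S = cong (_∨ does (o ∈? S)) (dec-false (o ℕ.≟ s) λ o≡s → <-irrefl (sym o≡s) s<o)

InRange : ℕ → ℕ → List ℕ → Set
InRange o e = All (λ s → o ≤ s × s < e)

InRange-empty : ∀ {o S} → InRange o o S → S ≡ []
InRange-empty []                = refl
InRange-empty ((o≤s , s<o) ∷ _) = ⊥-elim (<-irrefl refl (≤-<-trans o≤s s<o))

InRange-∉ : ∀ {o e S} → ¬ (o ∈ S) → InRange o e S → InRange (suc o) e S
InRange-∉ o∉S []                    = []
InRange-∉ o∉S ((o≤s , s<e) ∷ range) = (≤∧≢⇒< o≤s (o∉S ∘ here) , s<e) ∷ InRange-∉ (o∉S ∘ there) range

InRange-tail : ∀ {o e S} → Linked _<_ (o ∷ S) → InRange o e (o ∷ S) → InRange (suc o) e S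
InRange-tail sorted (_ ∷ range) with o<S ∷ _ ← Linked⇒AllPairs <-trans sorted =
  All.zipWith (λ (o<s , (_ , s<e)) → o<s , s<e) (o<S , range)

sorted-head : ∀ {o e s S} → o ∈ (s ∷ S) → Linked _<_ (s ∷ S) → InRange o e (s ∷ S) → s ≡ o
sorted-head (here o≡s)  _      _                 = sym o≡s
sorted-head (there o∈S) sorted ((o≤s , _) ∷ _) with s<S ∷ _ ← Linked⇒AllPairs <-trans sorted =
  ⊥-elim (≤⇒≯ o≤s (All.lookup s<S o∈S))

weightedGaps : (ℕ → ℕ) → ℕ → List ℕ → ℕ → ℕ
weightedGaps w a []      e = w (e ∸ a)
weightedGaps w a (s ∷ S) e = w (s ∸ a) * weightedGaps _! s S e

weightedGaps-! : ∀ a S e → weightedGaps _! a S e ≡ product (map _! (diffs (a ∷ S ++ [ e ])))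
weightedGaps-! a []      e = sym (*-identityʳ _)
weightedGaps-! a (s ∷ S) e = cong ((s ∸ a) ! *_) (weightedGaps-! s S e)

weightedGaps-signedPerms : ∀ a S e →
  weightedGaps signedPerms a S e ≡ 2 ^ (firstOr e S ∸ a) * weightedGaps _! a S e
weightedGaps-signedPerms a []      e = *-comm ((e ∸ a) !) _
weightedGaps-signedPerms a (s ∷ S) e = begin
  (s ∸ a) ! * 2 ^ (s ∸ a) * W    ≡⟨ cong (_* W) (*-comm ((s ∸ a) !) _) ⟩
  2 ^ (s ∸ a) * (s ∸ a) ! * W    ≡⟨ *-assoc (2 ^ (s ∸ a)) _ W ⟩
  2 ^ (s ∸ a) * ((s ∸ a) ! * W)  ∎
  where W = weightedGaps _! s S e

weightedBlocks-indicator : ∀ (w : ℕ → ℕ) k {a c o e} S → a + c ≡ o → o + k ≡ e →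
  Linked _<_ S → InRange o e S → weightedBlocks w c (indicator o k S) ≡ weightedGaps w a S e
weightedBlocks-indicator w zero {a} {c} {o} S a+c≡o o+0≡e _ range
  rewrite sym o+0≡e | +-identityʳ o | InRange-empty range | sym a+c≡o | m+n∸m≡n a c = refl
weightedBlocks-indicator w (suc k) {o = o} S a+c≡o o+k≡e sorted range with o ∈? S
... | no o∉S = weightedBlocks-indicator w k S (trans (+-suc _ _) (cong suc a+c≡o)) (trans (sym (+-suc o k)) o+k≡e)
                                        sorted (InRange-∉ o∉S range)
weightedBlocks-indicator w (suc k) {a} {c} {o} {e} (s ∷ S) a+c≡o o+k≡e sorted range | yes o∈S
  with refl ← sorted-head o∈S sorted range = begin
  w c * weightedBlocks _! 1 (indicator (suc o) k (o ∷ S))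
    ≡⟨ cong (λ E → w c * weightedBlocks _! 1 E) (indicator-∷-< k S (n<1+n o)) ⟩
  w c * weightedBlocks _! 1 (indicator (suc o) k S)
    ≡⟨ cong (w c *_) (weightedBlocks-indicator _! k S (+-comm o 1) (trans (sym (+-suc o k)) o+k≡e)
                                                 (Linked.tail sorted) (InRange-tail sorted range)) ⟩
  w c * weightedGaps _! o S e
    ≡⟨ cong (λ x → w x * weightedGaps _! o S e) (trans (cong (_∸ a) (sym a+c≡o)) (m+n∸m≡n a c)) ⟨
  w (o ∸ a) * weightedGaps _! o S e
    ∎

firstOr-≤ : ∀ {o e S} → InRange o e S → firstOr e S ≤ e
firstOr-≤ []              = ≤-refl
firstOr-≤ ((_ , s<e) ∷ _) = <⇒≤ s<e

weightedBlocks-signedPerms-indicator : ∀ n S → Linked _<_ S → InRange 1 n S →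
  weightedBlocks signedPerms 0 (indicator 0 n S) ≡ 2 ^ firstOr n S * prodFactGaps n S
weightedBlocks-signedPerms-indicator n S sorted range = begin
  weightedBlocks signedPerms 0 (indicator 0 n S)
    ≡⟨ weightedBlocks-indicator signedPerms n S refl refl sorted (All.map (λ (_ , s<n) → z≤n , s<n) range) ⟩
  weightedGaps signedPerms 0 S n
    ≡⟨ weightedGaps-signedPerms 0 S n ⟩
  2 ^ firstOr n S * weightedGaps _! 0 S n
    ≡⟨ cong (2 ^ firstOr n S *_) (weightedGaps-! 0 S n) ⟩
  2 ^ firstOr n S * prodFactGaps n S
    ∎

σat≗lookup : ∀ {n} (w : Vec ℤ n) j → σat w j ≡ lookup (+ 0 ∷ w) j
σat≗lookup w zero    = refl
σat≗lookup w (suc j) = refl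

DesSubset⇔descentsWithin : ∀ n (w : Vec ℤ n) S →
  DesSubset n w S ⇔ T (descentsWithin (indicator 0 n S) (+ 0 ∷ w))
DesSubset⇔descentsWithin n w S = mk⇔
  (λ des → from (T-descentsWithin⇔ E (+ 0 ∷ w)) λ i desc →
     from (∈S⇔ i) (des i (subst (lookup w i ℤ.<_) (sym (σat≗lookup w (inject₁ i))) desc)))
  (λ t i desc → to (∈S⇔ i) (to (T-descentsWithin⇔ E (+ 0 ∷ w)) t i
                                (subst (lookup w i ℤ.<_) (σat≗lookup w (inject₁ i)) desc)))
  where
  E = indicator 0 n S
  ∈S⇔ : ∀ i → T (lookup E i) ⇔ toℕ i ∈ S
  ∈S⇔ i = subst (λ b → T b ⇔ toℕ i ∈ S) (sym (lookup-indicator 0 n S i)) (T-does⇔ (toℕ i ∈? S))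

1≤∣i∣∧i≮0⇒0<i : ∀ i → 1 ≤ ∣ i ∣ → ¬ (i ℤ.< + 0) → + 0 ℤ.< i
1≤∣i∣∧i≮0⇒0<i (+ suc _) _ _    = +<+ (s≤s z≤n)
1≤∣i∣∧i≮0⇒0<i -[1+ _ ]  _ i≮0 = ⊥-elim (i≮0 -<+)

DesSubset⇒IsPositiveFirst : ∀ {n w S} → IsSignedPerm n w → InRange 1 n S →
                            DesSubset n w S → IsPositiveFirst n w
DesSubset⇒IsPositiveFirst {w = w} (bounds , _) range des zero _ =
  1≤∣i∣∧i≮0⇒0<i (lookup w zero) (proj₁ (bounds zero)) λ w₀<0 → 0∉S (des zero w₀<0)
  where
  0∉S : ¬ (0 ∈ _)
  0∉S 0∈S with () ← proj₁ (All.lookup range 0∈S)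

Counted↔DesWithin : ∀ n S → InRange 1 n S → Counted n S ↔ DesWithin n (indicator 0 n S)
Counted↔DesWithin n S range =
  mk↔ₛ′ to′ from′ (λ _ → DesWithin-≡ {E = indicator 0 n S} refl) (λ (w , _) → cong (w ,_) (T-irrelevant _ _))
  where
  to′ : Counted n S → DesWithin n (indicator 0 n S)
  to′ (w , c) with sp , _ , des ← toWitness c = w , fromWitness sp , to (DesSubset⇔descentsWithin n w S) des
  from′ : DesWithin n (indicator 0 n S) → Counted n S
  from′ (w , sp , d) = w , fromWitness (toWitness sp , DesSubset⇒IsPositiveFirst (toWitness sp) range des , des)
    where des = from (DesSubset⇔descentsWithin n w S) d

lemma4p1 : (n : ℕ) → 1 ≤ n → (S : List ℕ) → Linked _<_ S →
             All (λ s → 1 ≤ s × s < n) S →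
             (α : ℕ) → Fin α ↔ Counted n S →
             α * prodFactGaps n S ≡ n ! * 2 ^ (n ∸ firstOr n S)
lemma4p1 n _ S sorted range α α↔Counted = *-cancelʳ-≡ _ _ (2 ^ f) {{m^n≢0 2 f}} (begin
  α * P * 2 ^ f                               ≡⟨ cong (λ a → a * P * 2 ^ f) α≡count ⟩
  count n E * P * 2 ^ f                       ≡⟨ *-assoc (count n E) P (2 ^ f) ⟩
  count n E * (P * 2 ^ f)                     ≡⟨ cong (count n E *_) (*-comm P (2 ^ f)) ⟩
  count n E * (2 ^ f * P)                     ≡⟨ cong (count n E *_) blocks≡ ⟨
  count n E * weightedBlocks signedPerms 0 E  ≡⟨ count*weightedBlocks n E ⟩
  n ! * 2 ^ n                                 ≡⟨ cong (λ k → n ! * 2 ^ k) (m∸n+n≡m (firstOr-≤ range)) ⟨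
  n ! * 2 ^ (n ∸ f + f)                       ≡⟨ cong (n ! *_) (^-distribˡ-+-* 2 (n ∸ f) f) ⟩
  n ! * (2 ^ (n ∸ f) * 2 ^ f)                 ≡⟨ *-assoc (n !) _ _ ⟨
  n ! * 2 ^ (n ∸ f) * 2 ^ f                   ∎)
  where
  f = firstOr n S
  P = prodFactGaps n S
  E = indicator 0 n S
  α≡count : α ≡ count n E
  α≡count = ↔⇒≡ (↔-trans α↔Counted (↔-trans (Counted↔DesWithin n S range) (DesWithin↔Fin-count n E)))
  blocks≡ : weightedBlocks signedPerms 0 E ≡ 2 ^ f * P
  blocks≡ = weightedBlocks-signedPerms-indicator n S sorted range
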